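{- For every integer $n\ge 4$ and every integer $\Delta$ with $\lceil (n+2)/2\rceil\le \Delta\le n-1$, there exists a strong bicentral $2$-tree on $n$ vertices with maximum degree $\Delta$ and tail set $\{2,3\}$.
   Context: A $2$-tree is a graph obtained from the triangle $K_3$ by repeatedly adding a new vertex adjacent to both endpoints of an existing edge. For $r\in\{1,2,3\}$ and an integer $\Delta\ge 2$, a $2$-tree on $n$ vertices is $r$-central with maximum degree $\Delta$ if $\Delta$ is its maximum degree and exactly $r$ vertices have degree $\Delta$; these $r$ vertices form the core and the other $n-r$ vertices form the tail. It is strong if the core induces $K_r$. It has tail set $\{2,3\}$ if every tail vertex has degree $2$ or $3$. "Bicentral" means $2$-central. -}

module Defs where

open import Data.Nat using (ℕ; zero; suc; _≤_)
open import Data.Bool using (Bool; true; false; not; _∨_)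
open import Data.Fin using (Fin; zero; suc; _≟_)
open import Data.List using (List; map; allFin)
open import Data.Nat.ListAction using (sum)
open import Data.Product using (Σ; ∃; ∃-syntax; _×_)
open import Data.Sum using (_⊎_)
open import Relation.Nullary using (¬_; does)
open import Relation.Binary.PropositionalEquality using (_≡_; _≢_)

Graph : ℕ → Set
Graph n = Fin n → Fin n → Bool

K₃ : Graph 3
K₃ i j = not (does (i ≟ j))

addVertex : ∀ {n} → Graph n → Fin n → Fin n → Graph (suc n)
addVertex G u v zero    zero    = false
addVertex G u v zero    (suc j) = does (j ≟ u) ∨ does (j ≟ v)
addVertex G u v (suc i) zero    = does (i ≟ u) ∨ does (i ≟ v)
addVertex G u v (suc i) (suc j) = G i j

-- 2-trees: obtained from K₃ by repeatedly adding a new vertex adjacent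
-- to both endpoints of an existing edge.  (Vertices are labelled so that
-- the most recently added vertex is zero; every 2-tree is isomorphic to
-- one of these, and all properties below are isomorphism-invariant.)
data TwoTree : (n : ℕ) → Graph n → Set where
  triangle : TwoTree 3 K₃
  extend   : ∀ {n G} → TwoTree n G → (u v : Fin n) → G u v ≡ true →
             TwoTree (suc n) (addVertex G u v)

b2n : Bool → ℕ
b2n true = 1
b2n false = 0

deg : ∀ {n} → Graph n → Fin n → ℕ
deg {n} G i = sum (map (λ j → b2n (G i j)) (allFin n))

MaxDegree : ∀ {n} → Graph n → ℕ → Set
MaxDegree {n} G Δ = (∀ i → deg G i ≤ Δ) × ∃[ i ] deg G i ≡ Δ

BicentralCore : ∀ {n} → Graph n → ℕ → Fin n → Fin n → Set
BicentralCore G Δ a b =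
  MaxDegree G Δ × a ≢ b × deg G a ≡ Δ × deg G b ≡ Δ ×
  (∀ i → deg G i ≡ Δ → i ≡ a ⊎ i ≡ b)

-- Strong bicentral with maximum degree Δ and tail set {2,3}:
-- the core {a,b} induces K₂ (a and b adjacent), and every tail vertex
-- has degree 2 or 3.
StrongBicentralTail23 : ∀ {n} → Graph n → ℕ → Set
StrongBicentralTail23 {n} G Δ =
  Σ (Fin n) λ a → Σ (Fin n) λ b →
    BicentralCore G Δ a b × G a b ≡ true ×
    (∀ i → i ≢ a → i ≢ b → deg G i ≡ 2 ⊎ deg G i ≡ 3)

{-# OPTIONS --safe #-}
-- Grow the triangle abc by fans: repeatedly adding a vertex adjacent to a and to the
-- previously added vertex raises deg a by one and leaves every vertex other than a, b
-- of degree 2 or 3.  A fan of p vertices at a, a new common neighbour of a and b, a fan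
-- of p vertices at b and m further common neighbours give a strong bicentral 2-tree on
-- n = m + 2p + 4 vertices with Δ = m + p + 3; the bounds on Δ say exactly that
-- p = n - 1 - Δ and m = 2Δ - n - 2 are natural numbers.  When Δ = 3 (n = 4) all tail
-- vertices have degree 2, so they still lie outside the core.
module Submission where

open import Defs
open import Data.Bool using (Bool; true; false; not; _∨_)
open import Data.Bool.Properties using (∨-comm; ∨-zeroʳ)
open import Data.Empty using (⊥-elim)
open import Data.Fin using (Fin; zero; suc; _≟_)
open import Data.Fin.Properties using (suc-injective)
open import Data.List using (tabulate)
open import Data.List.Properties using (map-tabulate; tabulate-cong)
open import Data.Nat using (ℕ; zero; suc; _≤_; _<_; _+_; _∸_; ⌈_/2⌉; ⌊_/2⌋; z≤n; s≤s)
open import Data.Nat.ListAction using (sum)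
open import Data.Nat.Properties
  using (≤-refl; ≤-trans; ≤-reflexive; <⇒≤; <-irrefl; +-suc; +-comm; +-mono-≤;
         +-cancelˡ-≤; m≤n+m; m≤n⇒∃[o]m+o≡n; ⌊n/2⌋+⌈n/2⌉≡n; ⌊n/2⌋≤⌈n/2⌉; module ≤-Reasoning)
open import Data.Nat.Tactic.RingSolver using (solve-∀)
open import Data.Product using (Σ; _×_; _,_; proj₁; uncurry)
open import Data.Sum using (_⊎_; inj₁; inj₂)
open import Function using (_∘_; id)
open import Relation.Binary.PropositionalEquality
  using (_≡_; _≢_; _≗_; refl; sym; trans; cong; subst; subst₂; ≢-sym)
open import Relation.Nullary using (Dec; does; yes; no)
open import Relation.Nullary.Decidable using (dec-true; dec-false)

count : ∀ {n} → (Fin n → Bool) → ℕ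
count P = sum (tabulate (b2n ∘ P))

deg≡count : ∀ {n} (G : Graph n) i → deg G i ≡ count (G i)
deg≡count G i = cong sum (map-tabulate id (b2n ∘ G i))

count-cong : ∀ {n} {P Q : Fin n → Bool} → P ≗ Q → count P ≡ count Q
count-cong P≗Q = cong sum (tabulate-cong (cong b2n ∘ P≗Q))

count-false : ∀ n → count {n} (λ _ → false) ≡ 0
count-false zero    = refl
count-false (suc n) = count-false n

count-≡ : ∀ {n} (v : Fin n) → count (λ j → does (j ≟ v)) ≡ 1
count-≡ {suc n} zero    = cong suc (count-false n)
count-≡         (suc v) = count-≡ v

count-≡-∨-≡ : ∀ {n} (u v : Fin n) → u ≢ v →
              count (λ j → does (j ≟ u) ∨ does (j ≟ v)) ≡ 2
count-≡-∨-≡ zero    zero    u≢v = ⊥-elim (u≢v refl)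
count-≡-∨-≡ zero    (suc v) _   = cong suc (count-≡ v)
count-≡-∨-≡ (suc u) zero    u≢v =
  trans (count-cong (λ j → ∨-comm (does (j ≟ suc u)) (does (j ≟ zero))))
        (count-≡-∨-≡ zero (suc u) (≢-sym u≢v))
count-≡-∨-≡ (suc u) (suc v) u≢v = count-≡-∨-≡ u v (u≢v ∘ cong suc)

module _ {n} (G : Graph n) (u v : Fin n) where

  deg-addVertex-zero : u ≢ v → deg (addVertex G u v) zero ≡ 2
  deg-addVertex-zero u≢v = trans (deg≡count (addVertex G u v) zero) (count-≡-∨-≡ u v u≢v)

  deg-addVertex-suc : ∀ i →
                      deg (addVertex G u v) (suc i) ≡ b2n (does (i ≟ u) ∨ does (i ≟ v)) + deg G i
  deg-addVertex-suc i =
    trans (deg≡count (addVertex G u v) (suc i)) (cong (_ +_) (sym (deg≡count G i)))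

  deg-addVertex-left : deg (addVertex G u v) (suc u) ≡ suc (deg G u)
  deg-addVertex-left rewrite deg-addVertex-suc u | dec-true (u ≟ u) refl = refl

  deg-addVertex-right : deg (addVertex G u v) (suc v) ≡ suc (deg G v)
  deg-addVertex-right
    rewrite deg-addVertex-suc v | dec-true (v ≟ v) refl | ∨-zeroʳ (does (v ≟ u)) = refl

  deg-addVertex-other : ∀ {i} → i ≢ u → i ≢ v → deg (addVertex G u v) (suc i) ≡ deg G i
  deg-addVertex-other {i} i≢u i≢v
    rewrite deg-addVertex-suc i | dec-false (i ≟ u) i≢u | dec-false (i ≟ v) i≢v = refl

  addVertex-edge-left : addVertex G u v (suc u) zero ≡ true
  addVertex-edge-left rewrite dec-true (u ≟ u) refl = refl

does-≟-comm : ∀ {n} (i j : Fin n) → does (i ≟ j) ≡ does (j ≟ i)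
does-≟-comm zero    zero    = refl
does-≟-comm zero    (suc j) = refl
does-≟-comm (suc i) zero    = refl
does-≟-comm (suc i) (suc j) = does-≟-comm i j

twoTree-symmetric : ∀ {n G} → TwoTree n G → ∀ i j → G i j ≡ G j i
twoTree-symmetric triangle         i       j       = cong not (does-≟-comm i j)
twoTree-symmetric (extend _ _ _ _) zero    zero    = refl
twoTree-symmetric (extend _ _ _ _) zero    (suc j) = refl
twoTree-symmetric (extend _ _ _ _) (suc i) zero    = refl
twoTree-symmetric (extend t _ _ _) (suc i) (suc j) = twoTree-symmetric t i j

Tail23 : ℕ → Set
Tail23 d = d ≡ 2 ⊎ d ≡ 3

record Bicore (n dₐ d_b : ℕ) : Set where
  field
    graph   : Graph n
    twoTree : TwoTree n graph
    a b     : Fin n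
    a≢b     : a ≢ b
    edge    : graph a b ≡ true
    deg-a   : deg graph a ≡ dₐ
    deg-b   : deg graph b ≡ d_b
    tail    : ∀ i → i ≢ a → i ≢ b → Tail23 (deg graph i)

record Tip {n dₐ d_b} (s : Bicore n dₐ d_b) : Set where
  open Bicore s
  field
    c       : Fin n
    c≢a     : c ≢ a
    c≢b     : c ≢ b
    deg-c   : deg graph c ≡ 2
    edge-ac : graph a c ≡ true

open Bicore
open Tip

tail-addVertex-other : ∀ {n dₐ d_b} (s : Bicore n dₐ d_b) {u v i} →
                       i ≢ u → i ≢ v → i ≢ a s → i ≢ b s →
                       Tail23 (deg (addVertex (graph s) u v) (suc i))
tail-addVertex-other s {u} {v} {i} i≢u i≢v i≢a i≢b =
  subst Tail23 (sym (deg-addVertex-other (graph s) u v i≢u i≢v)) (tail s i i≢a i≢b)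

triangle-bicore : Σ (Bicore 3 2 2) Tip
triangle-bicore = record
  { graph = K₃ ; twoTree = triangle ; a = suc zero ; b = suc (suc zero)
  ; a≢b = λ () ; edge = refl ; deg-a = refl ; deg-b = refl ; tail = tail-K₃ }
  , record { c = zero ; c≢a = λ () ; c≢b = λ () ; deg-c = refl ; edge-ac = refl }
  where
  tail-K₃ : ∀ i → i ≢ suc zero → i ≢ suc (suc zero) → Tail23 (deg K₃ i)
  tail-K₃ zero             _   _   = inj₁ refl
  tail-K₃ (suc zero)       i≢a _   = ⊥-elim (i≢a refl)
  tail-K₃ (suc (suc zero)) _   i≢b = ⊥-elim (i≢b refl)

swap : ∀ {n dₐ d_b} → Bicore n dₐ d_b → Bicore n d_b dₐ
swap s = record
  { graph = graph s ; twoTree = twoTree s ; a = b s ; b = a s ; a≢b = ≢-sym (a≢b s)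
  ; edge = trans (twoTree-symmetric (twoTree s) (b s) (a s)) (edge s)
  ; deg-a = deg-b s ; deg-b = deg-a s ; tail = λ i i≢b i≢a → tail s i i≢a i≢b }

addCommon : ∀ {n dₐ d_b} → Bicore n dₐ d_b → Σ (Bicore (suc n) (suc dₐ) (suc d_b)) Tip
addCommon s = record
  { graph = G′ ; twoTree = extend (twoTree s) (a s) (b s) (edge s)
  ; a = suc (a s) ; b = suc (b s) ; a≢b = a≢b s ∘ suc-injective
  ; edge = edge s
  ; deg-a = trans (deg-addVertex-left (graph s) (a s) (b s)) (cong suc (deg-a s))
  ; deg-b = trans (deg-addVertex-right (graph s) (a s) (b s)) (cong suc (deg-b s))
  ; tail = tail′ }
  , record { c = zero ; c≢a = λ () ; c≢b = λ ()
           ; deg-c = deg-addVertex-zero (graph s) (a s) (b s) (a≢b s)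
           ; edge-ac = addVertex-edge-left (graph s) (a s) (b s) }
  where
  G′ = addVertex (graph s) (a s) (b s)
  tail′ : ∀ i → i ≢ suc (a s) → i ≢ suc (b s) → Tail23 (deg G′ i)
  tail′ zero    _   _   = inj₁ (deg-addVertex-zero (graph s) (a s) (b s) (a≢b s))
  tail′ (suc i) i≢a i≢b =
    tail-addVertex-other s (i≢a ∘ cong suc) (i≢b ∘ cong suc) (i≢a ∘ cong suc) (i≢b ∘ cong suc)

fan : ∀ {n dₐ d_b} (s : Bicore n dₐ d_b) → Tip s → Σ (Bicore (suc n) (suc dₐ) d_b) Tip
fan s t = record
  { graph = G′ ; twoTree = extend (twoTree s) (a s) (c t) (edge-ac t)
  ; a = suc (a s) ; b = suc (b s) ; a≢b = a≢b s ∘ suc-injective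
  ; edge = edge s
  ; deg-a = trans (deg-addVertex-left (graph s) (a s) (c t)) (cong suc (deg-a s))
  ; deg-b = trans (deg-addVertex-other (graph s) (a s) (c t) (≢-sym (a≢b s)) (≢-sym (c≢b t)))
                  (deg-b s)
  ; tail = tail′ }
  , record { c = zero ; c≢a = λ () ; c≢b = λ ()
           ; deg-c = deg-addVertex-zero (graph s) (a s) (c t) (≢-sym (c≢a t))
           ; edge-ac = addVertex-edge-left (graph s) (a s) (c t) }
  where
  G′ = addVertex (graph s) (a s) (c t)
  tail′ : ∀ i → i ≢ suc (a s) → i ≢ suc (b s) → Tail23 (deg G′ i)
  tail′ zero    _   _   = inj₁ (deg-addVertex-zero (graph s) (a s) (c t) (≢-sym (c≢a t)))
  tail′ (suc i) i≢a i≢b = tail-suc (i ≟ c t)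
    where
    tail-suc : Dec (i ≡ c t) → Tail23 (deg G′ (suc i))
    tail-suc (yes refl) = inj₂ (trans (deg-addVertex-right (graph s) (a s) (c t)) (cong suc (deg-c t)))
    tail-suc (no i≢c)   = tail-addVertex-other s (i≢a ∘ cong suc) i≢c (i≢a ∘ cong suc) (i≢b ∘ cong suc)

fans : ∀ p {n dₐ d_b} (s : Bicore n dₐ d_b) → Tip s → Σ (Bicore (p + n) (p + dₐ) d_b) Tip
fans zero    s t = s , t
fans (suc p) s t = uncurry fan (fans p s t)

addCommons : ∀ m {n dₐ d_b} → Bicore n dₐ d_b → Bicore (m + n) (m + dₐ) (m + d_b)
addCommons zero    s = s
addCommons (suc m) s = proj₁ (addCommon (addCommons m s))

construction : ∀ p m → Bicore (m + (p + suc (p + 3))) (m + (p + 3)) (m + (p + 3))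
construction p m =
  subst (Bicore _ _) (cong (m +_) (sym (+-suc p 2))) (addCommons m (proj₁ (uncurry (fans p) fan-at-b)))
  where
  fan-at-a : Σ (Bicore (p + 3) (p + 2) 2) Tip
  fan-at-a = uncurry (fans p) triangle-bicore
  fan-at-b : Σ (Bicore (suc (p + 3)) 3 (suc (p + 2))) Tip
  fan-at-b = addCommon (swap (proj₁ fan-at-a))

Tail23⇒< : ∀ {d Δ} → 4 ≤ Δ → Tail23 d → d < Δ
Tail23⇒< 4≤Δ (inj₁ refl) = <⇒≤ 4≤Δ
Tail23⇒< 4≤Δ (inj₂ refl) = 4≤Δ

construction-tail< : ∀ p m → let s = construction p m in
                     ∀ i → i ≢ a s → i ≢ b s → deg (graph s) i < m + (p + 3)
-- construction 0 0 is K₄ minus the edge 01, with core {3, 2}.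
construction-tail< zero    zero    zero                      _   _   = s≤s (s≤s (s≤s z≤n))
construction-tail< zero    zero    (suc zero)                _   _   = s≤s (s≤s (s≤s z≤n))
construction-tail< zero    zero    (suc (suc zero))          _   i≢b = ⊥-elim (i≢b refl)
construction-tail< zero    zero    (suc (suc (suc zero)))    i≢a _   = ⊥-elim (i≢a refl)
construction-tail< zero    (suc m) i i≢a i≢b =
  Tail23⇒< (s≤s (m≤n+m 3 m)) (tail (construction zero (suc m)) i i≢a i≢b)
construction-tail< (suc p) m       i i≢a i≢b =
  Tail23⇒< (≤-trans (s≤s (m≤n+m 3 p)) (m≤n+m _ m)) (tail (construction (suc p) m) i i≢a i≢b)

toStrongBicentral : ∀ {n Δ} (s : Bicore n Δ Δ) →
                    (∀ i → i ≢ a s → i ≢ b s → deg (graph s) i < Δ) →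
                    StrongBicentralTail23 (graph s) Δ
toStrongBicentral {Δ = Δ} s tail< =
  a s , b s , ((bounded , a s , deg-a s) , a≢b s , deg-a s , deg-b s , core) , edge s , tail s
  where
  bounded : ∀ i → deg (graph s) i ≤ Δ
  bounded i with i ≟ a s | i ≟ b s
  ... | yes refl | _        = ≤-reflexive (deg-a s)
  ... | no _     | yes refl = ≤-reflexive (deg-b s)
  ... | no i≢a   | no i≢b   = <⇒≤ (tail< i i≢a i≢b)
  core : ∀ i → deg (graph s) i ≡ Δ → i ≡ a s ⊎ i ≡ b s
  core i degΔ with i ≟ a s | i ≟ b s
  ... | yes i≡a | _       = inj₁ i≡a
  ... | no _    | yes i≡b = inj₂ i≡b
  ... | no i≢a  | no i≢b  = ⊥-elim (<-irrefl degΔ (tail< i i≢a i≢b))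

StrongBicentralTwoTree : ℕ → ℕ → Set
StrongBicentralTwoTree n Δ = Σ (Graph n) λ G → TwoTree n G × StrongBicentralTail23 G Δ

strongBicentralTwoTree : ∀ p m → StrongBicentralTwoTree (m + (p + suc (p + 3))) (m + (p + 3))
strongBicentralTwoTree p m =
  graph s , twoTree s , toStrongBicentral s (construction-tail< p m)
  where s = construction p m

⌈n/2⌉≤m⇒n≤m+m : ∀ {n m} → ⌈ n /2⌉ ≤ m → n ≤ m + m
⌈n/2⌉≤m⇒n≤m+m {n} {m} ⌈n/2⌉≤m = begin
  n                     ≡⟨ sym (⌊n/2⌋+⌈n/2⌉≡n n) ⟩
  ⌊ n /2⌋ + ⌈ n /2⌉     ≤⟨ +-mono-≤ (⌊n/2⌋≤⌈n/2⌉ n) ≤-refl ⟩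
  ⌈ n /2⌉ + ⌈ n /2⌉     ≤⟨ +-mono-≤ ⌈n/2⌉≤m ⌈n/2⌉≤m ⟩
  m + m                 ∎
  where open ≤-Reasoning

⌈Δ+p+3/2⌉≤Δ⇒p+3≤Δ : ∀ Δ p → ⌈ suc (Δ + p) + 2 /2⌉ ≤ Δ → p + 3 ≤ Δ
⌈Δ+p+3/2⌉≤Δ⇒p+3≤Δ Δ p h =
  +-cancelˡ-≤ Δ (p + 3) Δ (subst (_≤ Δ + Δ) (rearrange Δ p) (⌈n/2⌉≤m⇒n≤m+m h))
  where
  rearrange : ∀ Δ p → suc (Δ + p) + 2 ≡ Δ + (p + 3)
  rearrange = solve-∀

theorem4p9 : (n Δ : ℕ) → 4 ≤ n → ⌈ n + 2 /2⌉ ≤ Δ → Δ ≤ n ∸ 1 →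
    Σ (Graph n) λ G → TwoTree n G × StrongBicentralTail23 G Δ
-- 4 ≤ n is implied by the bounds on Δ.
theorem4p9 (suc n) Δ _ ⌈n+2/2⌉≤Δ Δ≤n with m≤n⇒∃[o]m+o≡n Δ≤n
... | p , refl with m≤n⇒∃[o]m+o≡n (⌈Δ+p+3/2⌉≤Δ⇒p+3≤Δ Δ p ⌈n+2/2⌉≤Δ)
... | m , refl =
  subst₂ StrongBicentralTwoTree (size m p) (+-comm m (p + 3)) (strongBicentralTwoTree p m)
  where
  size : ∀ m p → m + (p + suc (p + 3)) ≡ suc (p + 3 + m + p)
  size = solve-∀
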